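{- Let $A_t$ and $\mathsf{type}$ be as in the context, and let $P_t$ be the $2\times 2t$ 0--1 matrix whose first row has 1s exactly in columns $1,3,5,\dots,2t-1$ and $2t$, and whose second row has 1s exactly in columns $2,4,\dots,2t-2$ and $2t$. Consider an occurrence of $P_t$ in $A_t$, i.e. rows $a<b$ and columns $c=c'_1<c'_2<\cdots<c'_{2t}=d$ of $A_t$ (all in $\mathcal{I}$) such that $A_t(a,c'_j)=1$ whenever $P_t(1,j)=1$ and $A_t(b,c'_j)=1$ whenever $P_t(2,j)=1$. If $\mathsf{type}(a,b)\le\mathsf{type}(c,d)$, then $\mathsf{type}(a,b)=\mathsf{type}(c,d)=1$.
   Context: Let $[k]=\{1,\dots,k\}$, $t\ge 2$ a fixed integer and $k$ a positive integer. Let $\mathcal{I}=[k^t]^{tk}$; an element $a\in\mathcal{I}$ is viewed as $t$ consecutive blocks of length $k$, $a(p)$ denotes its $p$-th block and $a(p,q)$ the $q$-th coordinate of the $p$-th block. $\mathcal{I}$ is ordered lexicographically. For $r\ge 0$ and $(j_1,\dots,j_r)\in[k]^r$ let $\langle j_1,\dots,j_r\rangle=1+\sum_{s=1}^r (j_s-1)k^{r-s}$ (with $\langle\ \rangle=1$). For $(j_1,\dots,j_t)\in[k]^t$, $\mathbf{v}[j_1,\dots,j_t]\in\mathbb{Z}^{tk}$ is $0$ in every coordinate except that coordinate $(r,j_r)$ equals $\langle j_1,\dots,j_{r-1}\rangle$ for each $r\in[t]$; $\mathcal{S}$ is the set of all such vectors. $A_t$ is the 0--1 matrix with rows and columns indexed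 by $\mathcal{I}$ in lexicographic order, $A_t(a,b)=1$ iff $b-a\in\mathcal{S}$. For distinct $a,b\in\mathcal{I}$, $\mathsf{type}(a,b)=\min\{r : a(r)\ne b(r)\}$. -}

module Defs where

open import Data.Nat using (ℕ; zero; suc; _+_; _*_; _∸_; _^_; _<_; _≤_; _≡ᵇ_; _%_)
open import Data.Fin using (Fin; toℕ)
import Data.Fin as F
import Data.Nat
import Relation.Nullary
open import Data.Bool using (Bool; true; false; _∨_; _∧_)
open import Data.List using (List; foldl; take)
open import Data.Vec using (toList; tabulate)
open import Data.Product using (Σ; ∃; _×_)
open import Data.Sum using (_⊎_)
open import Relation.Binary.PropositionalEquality using (_≡_; _≢_)

-- Elements of 𝓘 = [k^t]^{tk}: t blocks of length k, a p q = a(p+1,q+1) (0-indexed).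
-- A value v : Fin (k^t) represents the number toℕ v + 1 ∈ [k^t]
-- (a uniform shift, irrelevant for differences b - a).
I : ℕ → ℕ → Set
I t k = Fin t → Fin k → Fin (k ^ t)

_<lex_ : ∀ {t k} → I t k → I t k → Set
_<lex_ {t} {k} a b =
  Σ (Fin t) λ p → Σ (Fin k) λ q →
    ((p' : Fin t) (q' : Fin k) → (p' F.< p ⊎ (p' ≡ p × q' F.< q)) → a p' q' ≡ b p' q')
    × (toℕ (a p q) < toℕ (b p q))

horner : ℕ → List ℕ → ℕ
horner k = foldl (λ acc x → acc * k + x) 0

-- ⟨ j₁ , … , j_{r} ⟩ = 1 + Σ_s (j_s - 1) k^{r-s}, where digits are 0-indexed here:
-- bracket k j r = ⟨ j(1), …, j(r) ⟩ for the first r entries of j (r = toℕ of a block index).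
bracket : ∀ {t k} → (Fin t → Fin k) → ℕ → ℕ
bracket {t} {k} j r = 1 + horner k (take r (toList (tabulate (λ s → toℕ (j s)))))

-- A_t(a,b) = 1  iff  b - a ∈ 𝓢, i.e. b - a = v[j₁,…,j_t] for some (j₁,…,j_t) ∈ [k]^t:
-- coordinate (r, j_r) of v equals ⟨j₁,…,j_{r-1}⟩, all other coordinates are 0.
vS : ∀ {t k} → (Fin t → Fin k) → Fin t → Fin k → ℕ
vS j r q with q F.≟ j r
... | Relation.Nullary.yes _ = bracket j (toℕ r)
... | Relation.Nullary.no _ = 0

A : ∀ {t k} → I t k → I t k → Set
A {t} {k} a b = Σ (Fin t → Fin k) λ j →
  (r : Fin t) (q : Fin k) → toℕ (b r q) ≡ toℕ (a r q) + vS j r q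

-- type(a,b) = r  (0-indexed block r): a(r) ≠ b(r) and a(r') = b(r') for all r' < r.
TypeIs : ∀ {t k} → I t k → I t k → Fin t → Set
TypeIs {t} {k} a b r =
  (Σ (Fin k) λ q → a r q ≢ b r q) ×
  ((r' : Fin t) → r' F.< r → (q : Fin k) → a r' q ≡ b r' q)

P : (t : ℕ) → Fin 2 → Fin (2 * t) → Bool
P t F.zero i = ((suc (toℕ i) % 2) ≡ᵇ 1) ∨ (suc (toℕ i) ≡ᵇ 2 * t)
P t (F.suc F.zero) i =
  (((suc (toℕ i) % 2) ≡ᵇ 0) ∧ (suc (toℕ i) Data.Nat.≤ᵇ (2 * t ∸ 2))) ∨ (suc (toℕ i) ≡ᵇ 2 * t)

-- Number blocks from 0 and write the columns as x₀ < y₀ < x₁ < ⋯ < y_{t-2} < x_{t-1} < d, where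
-- each xᵢ is a shift a + v[·], each yᵢ a shift b + v[·], and d = a + v[j] = b + v[j']; x₀ and d agree
-- on their first s = type(x₀, d) blocks. Inductively xᵢ agrees with d on its first s + i blocks.
-- Otherwise xᵢ₊₁ first differs from d at some (p, q) with p = s + i ≥ type(a, b). As xᵢ and xᵢ₊₁
-- agree up to (p, q), so does yᵢ, which lies between them; hence yᵢ also first differs from d at
-- (p, q). Neither xᵢ₊₁ nor yᵢ is shifted at (p, q), so a and b agree there, and reading
-- d = a + v[j] = b + v[j'] at (p, q) gives j_p = j'_p = q and equal brackets at block p. Brackets
-- are base-k expansions of digit prefixes, so v[j] and v[j'] agree on the blocks ≤ p, and then
-- so do a and b, contradicting p ≥ type(a, b). Finally x_{t-1} < d agree on s + t - 1 blocks,
-- which forces s = 0.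

module Submission where

open import Defs
open import Data.Bool using (true)
open import Data.Bool.Properties using (T-≡; T-∨)
open import Data.Empty using (⊥; ⊥-elim)
open import Data.Fin using (Fin; zero; suc; toℕ)
import Data.Fin as F
open import Data.Fin.Properties using (toℕ-injective; toℕ<n)
import Data.Fin.Properties as FinP
open import Data.List using (List; []; _∷_; foldl; take; length)
open import Data.List.Properties using (∷-injectiveˡ; ∷-injectiveʳ; length-take)
open import Data.List.Relation.Unary.All using (All; []; _∷_)
open import Data.List.Relation.Unary.All.Properties using (take⁺)
open import Data.Nat using (ℕ; zero; suc; _+_; _*_; _∸_; _^_; _⊓_; _≤_; _<_; s≤s; s≤s⁻¹; z≤n; NonZero)
open import Data.Nat.DivMod using (_mod_; [m+kn]%n≡m%n; m*n%n≡0; m<n⇒m%n≡m)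
open import Data.Nat.Properties
open import Data.Product using (∃; _×_; _,_; proj₁; proj₂)
open import Data.Product.Relation.Binary.Lex.Strict using (×-Lex; ×-isStrictTotalOrder)
open import Data.Product.Relation.Binary.Pointwise.NonDependent using (Pointwise)
open import Data.Sum using (inj₁; inj₂)
open import Data.Vec using (toList; tabulate)
open import Data.Vec.Properties using (length-toList)
import Data.Vec.Relation.Unary.All.Properties as VecAll
open import Function using (_∘_)
open import Function.Bundles using (Equivalence)
open import Relation.Binary.Definitions using (Transitive; Trichotomous; tri<; tri≈; tri>)
open import Relation.Binary.PropositionalEquality
open import Relation.Binary.Structures using (IsStrictTotalOrder)
open import Relation.Nullary using (yes; no; ¬_)

private variable
  t k n : ℕ
  X : Set
  a b x y z d : I t k
  j j' : Fin t → Fin k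
  p r : Fin t
  q : Fin k

foldl-horner : ∀ k acc xs →
  foldl (λ acc x → acc * k + x) acc xs ≡ acc * k ^ length xs + horner k xs
foldl-horner k acc [] = sym (trans (+-identityʳ _) (*-identityʳ acc))
foldl-horner k acc (x ∷ xs) = begin
  foldl _ (acc * k + x) xs               ≡⟨ foldl-horner k (acc * k + x) xs ⟩
  (acc * k + x) * K + horner k xs        ≡⟨ cong (_+ horner k xs) (*-distribʳ-+ K (acc * k) x) ⟩
  (acc * k * K + x * K) + horner k xs    ≡⟨ +-assoc (acc * k * K) (x * K) (horner k xs) ⟩
  acc * k * K + (x * K + horner k xs)    ≡⟨ cong₂ _+_ (*-assoc acc k K) (sym (foldl-horner k x xs)) ⟩
  acc * (k * K) + horner k (x ∷ xs)      ∎
  where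
    K = k ^ length xs
    open ≡-Reasoning

horner-∷ : ∀ k x xs → horner k (x ∷ xs) ≡ x * k ^ length xs + horner k xs
horner-∷ k = foldl-horner k

horner-< : ∀ k xs → All (_< k) xs → horner k xs < k ^ length xs
horner-< k [] [] = s≤s z≤n
horner-< k (x ∷ xs) (x<k ∷ xs<k) = begin-strict
  horner k (x ∷ xs)     ≡⟨ horner-∷ k x xs ⟩
  x * K + horner k xs   <⟨ +-monoʳ-< (x * K) (horner-< k xs xs<k) ⟩
  x * K + K             ≡⟨ +-comm (x * K) K ⟩
  suc x * K             ≤⟨ *-monoˡ-≤ K x<k ⟩
  k * K                 ∎
  where
    K = k ^ length xs
    open ≤-Reasoning

quotient-unique : ∀ K x x' {h h'} → h < K → h' < K → x * K + h ≡ x' * K + h' → x ≡ x'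
quotient-unique K zero zero _ _ _ = refl
quotient-unique K zero (suc x') {h} h<K _ eq =
  ⊥-elim (<⇒≱ h<K (subst (K ≤_) (sym eq) (≤-trans (m≤m+n K (x' * K)) (m≤m+n _ _))))
quotient-unique K (suc x) zero {h' = h'} _ h'<K eq =
  ⊥-elim (<⇒≱ h'<K (subst (K ≤_) eq (≤-trans (m≤m+n K (x * K)) (m≤m+n _ _))))
quotient-unique K (suc x) (suc x') {h} {h'} h<K h'<K eq = cong suc
  (quotient-unique K x x' h<K h'<K
    (+-cancelˡ-≡ K _ _ (trans (sym (+-assoc K (x * K) h)) (trans eq (+-assoc K (x' * K) h')))))

horner-injective : ∀ k {xs ys} → length xs ≡ length ys →
  All (_< k) xs → All (_< k) ys → horner k xs ≡ horner k ys → xs ≡ ys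
horner-injective k {[]} {[]} _ _ _ _ = refl
horner-injective k {x ∷ xs} {y ∷ ys} len (x<k ∷ xs<k) (y<k ∷ ys<k) eq =
  cong₂ _∷_ x≡y (horner-injective k len' xs<k ys<k (+-cancelˡ-≡ (x * K) _ _ eq'))
  where
    len' = suc-injective len
    K = k ^ length xs
    ys<K : horner k ys < K
    ys<K = subst (λ m → horner k ys < k ^ m) (sym len') (horner-< k ys ys<k)
    split : x * K + horner k xs ≡ y * K + horner k ys
    split = trans (sym (horner-∷ k x xs))
              (trans eq (trans (horner-∷ k y ys) (cong (λ m → y * k ^ m + horner k ys) (sym len'))))
    x≡y : x ≡ y
    x≡y = quotient-unique K x y (horner-< k xs xs<k) ys<K split
    eq' : x * K + horner k xs ≡ x * K + horner k ys
    eq' = trans split (cong (λ z → z * K + horner k ys) (sym x≡y))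

prefix : ℕ → (Fin t → X) → List X
prefix n g = take n (toList (tabulate g))

prefix-cong : ∀ n (g h : Fin t → X) → (∀ s → toℕ s < n → g s ≡ h s) → prefix n g ≡ prefix n h
prefix-cong {t = zero}  n       g h _  = refl
prefix-cong {t = suc t} zero    g h _  = refl
prefix-cong {t = suc t} (suc n) g h eq = cong₂ _∷_ (eq zero (s≤s z≤n))
  (prefix-cong n (g ∘ suc) (h ∘ suc) (λ s s<n → eq (suc s) (s≤s s<n)))

prefix-injective : ∀ n (g h : Fin t → X) → prefix n g ≡ prefix n h → ∀ s → toℕ s < n → g s ≡ h s
prefix-injective (suc n) g h eq zero    _         = ∷-injectiveˡ eq
prefix-injective (suc n) g h eq (suc s) (s≤s s<n) =
  prefix-injective n (g ∘ suc) (h ∘ suc) (∷-injectiveʳ eq) s s<n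

length-prefix : ∀ n (g : Fin t → X) → length (prefix n g) ≡ n ⊓ t
length-prefix n g = trans (length-take n _) (cong (n ⊓_) (length-toList (tabulate g)))

digits<k : ∀ n (j : Fin t → Fin k) → All (_< k) (prefix n (toℕ ∘ j))
digits<k n j = take⁺ n (VecAll.toList⁺ (VecAll.tabulate⁺ (toℕ<n ∘ j)))

bracket-cong : ∀ n (j j' : Fin t → Fin k) → (∀ s → toℕ s < n → j s ≡ j' s) →
  bracket j n ≡ bracket j' n
bracket-cong {k = k} n j j' eq =
  cong (suc ∘ horner k) (prefix-cong n _ _ (λ s s<n → cong toℕ (eq s s<n)))

bracket-injective : ∀ n (j j' : Fin t → Fin k) → bracket j n ≡ bracket j' n →
  ∀ s → toℕ s < n → j s ≡ j' s
bracket-injective {k = k} n j j' eq s s<n = toℕ-injective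
  (prefix-injective n _ _
    (horner-injective k (trans (length-prefix n _) (sym (length-prefix n _)))
      (digits<k n j) (digits<k n j') (suc-injective eq)) s s<n)

vS-on : (j : Fin t → Fin k) (r : Fin t) {q : Fin k} → q ≡ j r → vS j r q ≡ bracket j (toℕ r)
vS-on j r {q} q≡jr with q F.≟ j r
... | yes _    = refl
... | no  q≢jr = ⊥-elim (q≢jr q≡jr)

vS-off : (j : Fin t → Fin k) (r : Fin t) {q : Fin k} → q ≢ j r → vS j r q ≡ 0
vS-off j r {q} q≢jr with q F.≟ j r
... | yes q≡jr = ⊥-elim (q≢jr q≡jr)
... | no  _    = refl

vS-positive⇒digit : (j : Fin t → Fin k) (r : Fin t) {q : Fin k} → 0 < vS j r q → q ≡ j r
vS-positive⇒digit j r {q} pos with q F.≟ j r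
... | yes q≡jr = q≡jr
... | no  _    = ⊥-elim (n≮n 0 pos)

vS-prefix-cong : (j j' : Fin t → Fin k) (r : Fin t) (q : Fin k) →
  (∀ s → toℕ s ≤ toℕ r → j s ≡ j' s) → vS j r q ≡ vS j' r q
vS-prefix-cong j j' r q agree with q F.≟ j r
... | yes q≡jr = trans (bracket-cong (toℕ r) j j' (λ s s<r → agree s (<⇒≤ s<r)))
                       (sym (vS-on j' r (trans q≡jr (agree r ≤-refl))))
... | no  q≢jr = sym (vS-off j' r (λ q≡j'r → q≢jr (trans q≡j'r (sym (agree r ≤-refl)))))

_⟶[_]_ : I t k → (Fin t → Fin k) → I t k → Set
a ⟶[ j ] x = ∀ r q → toℕ (x r q) ≡ toℕ (a r q) + vS j r q

⟶-cancelˡ : a ⟶[ j ] x → b ⟶[ j' ] y → a r q ≡ b r q → x r q ≡ y r q → vS j r q ≡ vS j' r q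
⟶-cancelˡ {r = r} {q = q} hx hy a≡b x≡y = +-cancelˡ-≡ _ _ _
  (trans (sym (hx r q)) (trans (cong toℕ x≡y) (trans (hy r q) (cong (λ c → toℕ c + _) (sym a≡b)))))

⟶-cancelʳ : a ⟶[ j ] d → b ⟶[ j' ] d → vS j r q ≡ vS j' r q → a r q ≡ b r q
⟶-cancelʳ {r = r} {q = q} ha hb eq =
  toℕ-injective (+-cancelʳ-≡ _ _ _ (trans (sym (ha r q)) (trans (hb r q) (cong (_ +_) (sym eq)))))

⟶-off : a ⟶[ j ] x → q ≢ j r → x r q ≡ a r q
⟶-off {j = j} {q = q} {r = r} hx q≢jr =
  toℕ-injective (trans (hx r q) (trans (cong (_ +_) (vS-off j r q≢jr)) (+-identityʳ _)))

⟶-digit : a ⟶[ j ] x → a ⟶[ j' ] y → (∀ q → x r q ≡ y r q) → j r ≡ j' r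
⟶-digit {j = j} {j' = j'} {r = r} hx hy eq = vS-positive⇒digit j' r
  (subst (0 <_) (trans (sym (vS-on j r refl)) (⟶-cancelˡ hx hy refl (eq (j r)))) (s≤s z≤n))

Pos : ℕ → ℕ → Set
Pos t k = Fin t × Fin k

_<ₚ_ : Pos t k → Pos t k → Set
_<ₚ_ = ×-Lex _≡_ F._<_ F._<_

<ₚ-isStrictTotalOrder : IsStrictTotalOrder (Pointwise _≡_ _≡_) (_<ₚ_ {t} {k})
<ₚ-isStrictTotalOrder = ×-isStrictTotalOrder FinP.<-isStrictTotalOrder FinP.<-isStrictTotalOrder

<ₚ-trans : Transitive (_<ₚ_ {t} {k})
<ₚ-trans = IsStrictTotalOrder.trans <ₚ-isStrictTotalOrder

<ₚ-cmp : Trichotomous (Pointwise _≡_ _≡_) (_<ₚ_ {t} {k})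
<ₚ-cmp = IsStrictTotalOrder.compare <ₚ-isStrictTotalOrder

_!_ : I t k → Pos t k → Fin (k ^ t)
x ! (p , q) = x p q

AgreeBefore : I t k → I t k → Pos t k → Set
AgreeBefore x y u = ∀ v → v <ₚ u → x ! v ≡ y ! v

FirstDifference : I t k → I t k → Pos t k → Set
FirstDifference x y u = AgreeBefore x y u × toℕ (x ! u) < toℕ (y ! u)

first-difference : x <lex y → ∃ (FirstDifference x y)
first-difference (p , q , before , lt) = (p , q) , (λ (p' , q') → before p' q') , lt

first-difference⁻¹ : ∀ {u} → FirstDifference x y u → x <lex y
first-difference⁻¹ {u = p , q} (before , lt) = p , q , (λ p' q' → before (p' , q')) , lt

<lex-trans : x <lex y → y <lex z → x <lex z
<lex-trans {x = x} {z = z} x<y y<z with first-difference x<y | first-difference y<z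
... | u , bef₁ , lt₁ | v , bef₂ , lt₂ with <ₚ-cmp u v
... | tri< u<v _ _ = first-difference⁻¹
  ( (λ w w<u → trans (bef₁ w w<u) (bef₂ w (<ₚ-trans w<u u<v)))
  , subst (λ c → toℕ (x ! u) < toℕ c) (bef₂ u u<v) lt₁ )
... | tri≈ _ (refl , refl) _ = first-difference⁻¹
  ( (λ w w<v → trans (bef₁ w w<v) (bef₂ w w<v))
  , <-trans lt₁ lt₂ )
... | tri> _ _ v<u = first-difference⁻¹
  ( (λ w w<v → trans (bef₁ w (<ₚ-trans w<v v<u)) (bef₂ w w<v))
  , subst (λ c → toℕ c < toℕ (z ! v)) (sym (bef₁ v v<u)) lt₂ )

no-room-between : ∀ {u} → FirstDifference x y u → y <lex z →
  AgreeBefore x z u → x ! u ≡ z ! u → ⊥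
no-room-between {x = x} {y = y} {z = z} {u = u} (bef₁ , lt₁) y<z xz xzᵤ with first-difference y<z
... | v , bef₂ , lt₂ with <ₚ-cmp u v
... | tri< u<v _ _ = <-irrefl (cong toℕ (trans xzᵤ (sym (bef₂ u u<v)))) lt₁
... | tri≈ _ (refl , refl) _ = <-asym lt₂ (subst (λ c → toℕ c < toℕ (y ! v)) xzᵤ lt₁)
... | tri> _ _ v<u = <-irrefl (cong toℕ (trans (sym (bef₁ v v<u)) (xz v v<u))) lt₂

<lex-between-at : x <lex y → y <lex z → ∀ u → AgreeBefore x z u → x ! u ≡ z ! u → y ! u ≡ x ! u
<lex-between-at x<y y<z u xz xzᵤ with first-difference x<y
... | u₁ , fd with <ₚ-cmp u u₁
... | tri< u<u₁ _ _ = sym (proj₁ fd u u<u₁)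
... | tri≈ _ (refl , refl) _ = ⊥-elim (no-room-between fd y<z xz xzᵤ)
... | tri> _ _ u₁<u =
  ⊥-elim (no-room-between fd y<z (λ w w<u₁ → xz w (<ₚ-trans w<u₁ u₁<u)) (xz u₁ u₁<u))

AgreeBelow : I t k → I t k → ℕ → Set
AgreeBelow {t} {k} x y n = (p : Fin t) → toℕ p < n → (q : Fin k) → x p q ≡ y p q

<lex-between-blocks : x <lex y → y <lex z → AgreeBelow x z n → AgreeBelow y z n
<lex-between-blocks {x = x} {z = z} x<y y<z xz p p<n q =
  trans (<lex-between-at x<y y<z (p , q) earlier (xz p p<n q)) (xz p p<n q)
  where
    earlier : AgreeBefore x z (p , q)
    earlier (p' , q') (inj₁ p'<p)       = xz p' (<-trans p'<p p<n) q'
    earlier (p' , q') (inj₂ (refl , _)) = xz p' p<n q'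

<lex⇒¬AgreeBelow : {x y : I t k} → x <lex y → t ≤ n → ¬ AgreeBelow x y n
<lex⇒¬AgreeBelow (p , q , _ , lt) t≤n agree =
  <-irrefl (cong toℕ (agree p (<-≤-trans (toℕ<n p) t≤n) q)) lt

AgreeBelow-suc : AgreeBelow x y n → (∀ p → toℕ p ≡ n → ∀ q → x p q ≡ y p q) → AgreeBelow x y (suc n)
AgreeBelow-suc below at p p<1+n with m≤n⇒m<n∨m≡n (s≤s⁻¹ p<1+n)
... | inj₁ p<n = below p p<n
... | inj₂ p≡n = at p p≡n

shift-first-difference : a ⟶[ j ] x → a ⟶[ j' ] y → FirstDifference x y (p , q) →
  q ≡ j' p × q F.< j p
shift-first-difference {j = j} {j' = j'} {p = p} {q = q} hx hy (before , x<y) = q≡j'p , q<jp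
  where
    same-bracket : bracket j (toℕ p) ≡ bracket j' (toℕ p)
    same-bracket = bracket-cong (toℕ p) j j'
      (λ s s<p → ⟶-digit hx hy (λ q' → before (s , q') (inj₁ s<p)))
    vS< : vS j p q < vS j' p q
    vS< = +-cancelˡ-< _ _ _ (subst₂ _<_ (hx p q) (hy p q) x<y)
    q≡j'p : q ≡ j' p
    q≡j'p = vS-positive⇒digit j' p (≤-<-trans z≤n vS<)
    q<jp : q F.< j p
    q<jp with FinP.<-cmp q (j p)
    ... | tri< q<jp _ _ = q<jp
    ... | tri≈ _ q≡jp _ = ⊥-elim (<-irrefl
      (trans (vS-on j p q≡jp) (trans same-bracket (sym (vS-on j' p q≡j'p)))) vS<)
    ... | tri> _ _ jp<q = ⊥-elim (0≢1+n (begin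
      0                       ≡⟨ sym (vS-off j' p jp≢j'p) ⟩
      vS j' p (j p)           ≡⟨ sym (⟶-cancelˡ hx hy refl (before (p , j p) (inj₂ (refl , jp<q)))) ⟩
      vS j p (j p)            ≡⟨ vS-on j p refl ⟩
      bracket j (toℕ p)       ∎))
      where
        open ≡-Reasoning
        jp≢j'p : j p ≢ j' p
        jp≢j'p jp≡j'p = FinP.<-irrefl (trans jp≡j'p (sym q≡j'p)) jp<q

crossing⇒rows-agree : {m j₃ j'' : Fin t → Fin k} {x' : I t k} →
  b ⟶[ m ] y → a ⟶[ j₃ ] x' → a ⟶[ j' ] d → b ⟶[ j'' ] d →
  FirstDifference y d (p , q) → FirstDifference x' d (p , q) → y p q ≡ x' p q →
  AgreeBelow a b (suc (toℕ p))
crossing⇒rows-agree {b = b} {a = a} {j' = j'} {p = p} {q = q} {j'' = j''}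
  hy hx' had hbd fd-y fd-x' y≡x' p' p'≤p q' =
  ⟶-cancelʳ had hbd
    (vS-prefix-cong j' j'' p' q' (λ s s≤p' → same-digits s (≤-trans s≤p' (s≤s⁻¹ p'≤p))))
  where
    open ≡-Reasoning
    q≡j''p = proj₁ (shift-first-difference hy hbd fd-y)
    q<mp   = proj₂ (shift-first-difference hy hbd fd-y)
    q≡j'p  = proj₁ (shift-first-difference hx' had fd-x')
    q<j₃p  = proj₂ (shift-first-difference hx' had fd-x')
    a≡b : a p q ≡ b p q
    a≡b = trans (sym (⟶-off hx' (FinP.<⇒≢ q<j₃p))) (trans (sym y≡x') (⟶-off hy (FinP.<⇒≢ q<mp)))
    same-bracket : bracket j' (toℕ p) ≡ bracket j'' (toℕ p)
    same-bracket = begin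
      bracket j' (toℕ p)   ≡⟨ sym (vS-on j' p q≡j'p) ⟩
      vS j' p q            ≡⟨ ⟶-cancelˡ had hbd a≡b refl ⟩
      vS j'' p q           ≡⟨ vS-on j'' p q≡j''p ⟩
      bracket j'' (toℕ p)  ∎
    same-digits : ∀ s → toℕ s ≤ toℕ p → j' s ≡ j'' s
    same-digits s s≤p with m≤n⇒m<n∨m≡n s≤p
    ... | inj₁ s<p = bracket-injective (toℕ p) j' j'' same-bracket s s<p
    ... | inj₂ s≡p rewrite toℕ-injective s≡p = trans (sym q≡j'p) q≡j''p

between-first-difference : {j₃ : Fin t → Fin k} {x' : I t k} →
  a ⟶[ j ] x → a ⟶[ j₃ ] x' → a ⟶[ j' ] d → x <lex y → y <lex x' →
  AgreeBelow x d (toℕ p) → AgreeBelow x' d (toℕ p) → FirstDifference x' d (p , q) →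
  FirstDifference y d (p , q) × y p q ≡ x' p q
between-first-difference {x = x} {d = d} {y = y} {p = p} {q = q} {x' = x'}
  hx hx' hd x<y y<x' xd x'd fd@(before , lt) with first-difference (<lex-trans x<y y<x')
... | (p₂ , q₂) , fd₂@(before₂ , lt₂) =
  (y-before , subst (λ c → toℕ c < toℕ (d p q)) (sym (y≡x' (p , q) pq<u₂)) lt) , y≡x' (p , q) pq<u₂
  where
    pq<u₂ : (p , q) <ₚ (p₂ , q₂)
    pq<u₂ with FinP.<-cmp p₂ p
    ... | tri< p₂<p _ _ =
      ⊥-elim (<-irrefl (cong toℕ (trans (xd p₂ p₂<p q₂) (sym (x'd p₂ p₂<p q₂)))) lt₂)
    ... | tri≈ _ refl _ = inj₂ (refl , subst (q F.<_)
            (sym (proj₁ (shift-first-difference hx hx' fd₂))) (proj₂ (shift-first-difference hx' hd fd)))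
    ... | tri> _ _ p<p₂ = inj₁ p<p₂
    y≡x' : ∀ v → v <ₚ (p₂ , q₂) → y ! v ≡ x' ! v
    y≡x' v v<u₂ = trans
      (<lex-between-at x<y y<x' v (λ w w<v → before₂ w (<ₚ-trans w<v v<u₂)) (before₂ v v<u₂))
      (before₂ v v<u₂)
    y-before : AgreeBefore y d (p , q)
    y-before v v<pq = trans (y≡x' v (<ₚ-trans v<pq pq<u₂)) (before v v<pq)

agreement-extends : {m j₃ j'' : Fin t → Fin k} {x' : I t k} →
  a ⟶[ j ] x → b ⟶[ m ] y → a ⟶[ j₃ ] x' → a ⟶[ j' ] d → b ⟶[ j'' ] d →
  x <lex y → y <lex x' → x' <lex d →
  (∃ λ q₀ → a r q₀ ≢ b r q₀) → toℕ r ≤ toℕ p →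
  AgreeBelow x d (toℕ p) → AgreeBelow x' d (toℕ p) → ∀ q → x' p q ≡ d p q
agreement-extends {r = r} {p = p} hx hy hx' had hbd x<y y<x' x'<d (q₀ , a≢b) r≤p xd x'd q
  with first-difference x'<d
... | (p₁ , q₁) , fd@(before , lt) with FinP.<-cmp p₁ p
... | tri< p₁<p _ _ = ⊥-elim (<-irrefl (cong toℕ (x'd p₁ p₁<p q₁)) lt)
... | tri> _ _ p<p₁ = before (p , q) (inj₁ p<p₁)
... | tri≈ _ refl _ =
  let fd-y , y≡x' = between-first-difference hx hx' had x<y y<x' xd x'd fd
  in ⊥-elim (a≢b (crossing⇒rows-agree hy hx' had hbd fd-y fd y≡x' r (s≤s r≤p) q₀))

agreement-grows : (x y : ℕ → I t k) (n s : ℕ) →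
  (∀ i → i ≤ n → A a (x i)) → (∀ i → i < n → A b (y i)) → A a d → A b d →
  (∀ i → i < n → x i <lex y i) → (∀ i → i < n → y i <lex x (suc i)) →
  (∀ i → i ≤ n → x i <lex d) →
  (∃ λ q₀ → a r q₀ ≢ b r q₀) → toℕ r ≤ s →
  AgreeBelow (x 0) d s → ∀ i → i ≤ n → AgreeBelow (x i) d (s + i)
agreement-grows {d = d} {r = r} x y n s x∈a y∈b (_ , had) (_ , hbd) x<y y<x x<d differ r≤s base = grow
  where
    grow : ∀ i → i ≤ n → AgreeBelow (x i) d (s + i)
    grow zero    _   = subst (AgreeBelow (x 0) d) (sym (+-identityʳ s)) base
    grow (suc i) i<n = subst (AgreeBelow (x (suc i)) d) (sym (+-suc s i)) (AgreeBelow-suc x'd at-s+i)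
      where
        xd  = grow i (<⇒≤ i<n)
        x'd = <lex-between-blocks (<lex-trans (x<y i i<n) (y<x i i<n)) (x<d (suc i) i<n) xd
        at-s+i : ∀ p → toℕ p ≡ s + i → ∀ q → x (suc i) p q ≡ d p q
        at-s+i p p≡s+i = agreement-extends
          (proj₂ (x∈a i (<⇒≤ i<n))) (proj₂ (y∈b i i<n)) (proj₂ (x∈a (suc i) i<n)) had hbd
          (x<y i i<n) (y<x i i<n) (x<d (suc i) i<n) differ
          (subst (toℕ r ≤_) (sym p≡s+i) (≤-trans r≤s (m≤m+n s i)))
          (subst (AgreeBelow (x i) d) (sym p≡s+i) xd) (subst (AgreeBelow (x (suc i)) d) (sym p≡s+i) x'd)

toℕ-mod : ∀ {i n} .⦃ _ : NonZero n ⦄ → i < n → toℕ (i mod n) ≡ i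
toℕ-mod i<n = trans (FinP.toℕ-fromℕ< _) (m<n⇒m%n≡m i<n)

P-even : ∀ t (j : Fin (2 * t)) i → toℕ j ≡ 2 * i → P t zero j ≡ true
P-even t j i j≡2i rewrite j≡2i | *-comm 2 i | [m+kn]%n≡m%n 1 i 2 ⦃ _ ⦄ = refl

P-odd : ∀ n (j : Fin (2 * suc n)) i → toℕ j ≡ suc (2 * i) → i < n → P (suc n) (suc zero) j ≡ true
P-odd n j i j≡1+2i i<n rewrite j≡1+2i | *-comm 2 i | m*n%n≡0 (suc i) 2 ⦃ _ ⦄ =
  Equivalence.to T-≡ (Equivalence.from T-∨ (inj₁ (≤⇒≤ᵇ bound)))
  where
    bound : suc i * 2 ≤ 2 * suc n ∸ 2
    bound = subst (suc i * 2 ≤_) (trans (*-comm n 2) (cong (_∸ 2) (sym (*-suc 2 n)))) (*-monoˡ-≤ 2 i<n)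

P-last : ∀ n row (j : Fin (2 * suc n)) → toℕ j ≡ 2 * suc n ∸ 1 → P (suc n) row j ≡ true
P-last n zero       j j≡last =
  Equivalence.to T-≡ (Equivalence.from T-∨ (inj₂ (≡⇒≡ᵇ _ _ (cong suc j≡last))))
P-last n (suc zero) j j≡last =
  Equivalence.to T-≡ (Equivalence.from T-∨ (inj₂ (≡⇒≡ᵇ _ _ (cong suc j≡last))))

lemma4 : (t k : ℕ) → 2 ≤ t → 1 ≤ k →
    (a b : I t k) → (c' : Fin (2 * t) → I t k) →
    a <lex b →
    ((i j : Fin (2 * t)) → i F.< j → c' i <lex c' j) →
    ((j : Fin (2 * t)) → P t zero j ≡ true → A a (c' j)) →
    ((j : Fin (2 * t)) → P t (suc zero) j ≡ true → A b (c' j)) →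
    (i₀ i₁ : Fin (2 * t)) → toℕ i₀ ≡ 0 → toℕ i₁ ≡ 2 * t Data.Nat.∸ 1 →
    (r s : Fin t) → TypeIs a b r → TypeIs (c' i₀) (c' i₁) s →
    toℕ r ≤ toℕ s →
    (toℕ r ≡ 0) × (toℕ s ≡ 0)
lemma4 (suc n@(suc _)) k (s≤s (s≤s z≤n)) _ a b c' _ c'-increasing a-row b-row i₀ i₁ i₀≡0 i₁≡last r s
  (differ , _) (_ , c-agree) r≤s = n≤0⇒n≡0 (subst (toℕ r ≤_) s≡0 r≤s) , s≡0
  where
    column : ℕ → I (suc n) k
    column i = c' (i mod (2 * suc n))
    even odd : ℕ → I (suc n) k
    even i = column (2 * i)
    odd  i = column (suc (2 * i))
    last = c' i₁
    even< : ∀ {i} → i ≤ n → 2 * i < 2 * suc n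
    even< i≤n = *-monoʳ-< 2 (s≤s i≤n)
    odd< : ∀ {i} → i < n → suc (2 * i) < 2 * suc n
    odd< {i} i<n = <-trans (n<1+n _) (subst (_< 2 * suc n) (*-suc 2 i) (even< i<n))
    column-< : ∀ {i j} → i < j → j < 2 * suc n → column i <lex column j
    column-< i<j j<2t = c'-increasing _ _
      (subst₂ _<_ (sym (toℕ-mod (<-trans i<j j<2t))) (sym (toℕ-mod j<2t)) i<j)
    even<odd : ∀ i → i < n → even i <lex odd i
    even<odd i i<n = column-< (n<1+n _) (odd< i<n)
    odd<even : ∀ i → i < n → odd i <lex even (suc i)
    odd<even i i<n = column-< (subst (suc (2 * i) <_) (sym (*-suc 2 i)) (n<1+n _)) (even< i<n)
    even<last : ∀ i → i ≤ n → even i <lex last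
    even<last i i≤n = c'-increasing _ _ (subst₂ _<_ (sym (toℕ-mod (even< i≤n)))
      (sym (trans i₁≡last (cong (_∸ 1) (*-suc 2 n)))) (s≤s (*-monoʳ-≤ 2 i≤n)))
    base : AgreeBelow (even 0) last (toℕ s)
    base = subst (λ c → AgreeBelow c last (toℕ s))
      (cong c' (toℕ-injective (trans i₀≡0 (sym (toℕ-mod (even< z≤n)))))) c-agree
    penultimate-agrees : AgreeBelow (even n) last (toℕ s + n)
    penultimate-agrees = agreement-grows even odd n (toℕ s)
      (λ i i≤n → a-row _ (P-even (suc n) _ i (toℕ-mod (even< i≤n))))
      (λ i i<n → b-row _ (P-odd n _ i (toℕ-mod (odd< i<n)) i<n))
      (a-row i₁ (P-last n zero i₁ i₁≡last)) (b-row i₁ (P-last n (suc zero) i₁ i₁≡last))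
      even<odd odd<even even<last differ r≤s base n ≤-refl
    s≡0 : toℕ s ≡ 0
    s≡0 with toℕ s | penultimate-agrees
    ... | zero   | _     = refl
    ... | suc s' | agree = ⊥-elim (<lex⇒¬AgreeBelow (even<last n ≤-refl) (s≤s (m≤n+m n s')) agree)
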